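{- For all positive integers $r$, $$D(2r,r)+\sum_{i=1}^{r-1}D(2i-2,i)<0.$$
   Context: For positive integers $n,r$ define $D(n,r):=\binom{n}{r-1}-\binom{n}{r}$ if $r\le n$, and $D(n,r):=0$ otherwise (in particular $D(0,r)=0$). -}

module Defs where

open import Data.Nat using (ℕ; zero; suc; _≤?_)
import Data.Nat
open import Data.Nat.Combinatorics using (_C_)
open import Data.Integer using (ℤ; +_; _-_; _+_)
open import Relation.Nullary using (yes; no)

D : ℕ → ℕ → ℤ
D n zero = + 0
D n (suc k) with suc k ≤? n
... | yes _ = (+ (n C k)) - (+ (n C (suc k)))
... | no _ = + 0

sumD : ℕ → ℤ
sumD zero = + 0
sumD (suc zero) = + 0
sumD (suc (suc k)) = sumD (suc k) + D (2 Data.Nat.* k) (suc k)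

-- Writing c_r = C(2r,r) − C(2r,r+1) for the Catalan numbers, D(2r,r) = −c_r and
-- D(2i−2,i) = c_{i−1} for i ≥ 2 (while D(0,1) = 0), so the claim is
-- c_0 + ⋯ + c_{r−2} < c_r.  Pascal's rule and unimodality of binomial rows give
-- c_{s+2} ≥ c_{s+1} + c_s, from which 1 + c_0 + ⋯ + c_{r−2} ≤ c_r follows by induction.
module Submission where

open import Defs
open import Data.Nat using (ℕ; zero; suc; _*_; z≤n; s≤s; _≤?_)
import Data.Nat
open Data.Nat using () renaming (_+_ to _+ℕ_; _≤_ to _≤ℕ_)
import Data.Nat.Properties as ℕ
open import Data.Nat.Combinatorics using (_C_; nCk+nC[k+1]≡[n+1]C[k+1]; nCk≡nC[n∸k])
open import Data.Integer using (ℤ; _+_; _-_; -_; _<_; _≤_; +_; 0ℤ; 1ℤ; +≤+)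
open import Data.Integer.Properties hiding (_≤?_)
open import Data.Integer.Tactic.RingSolver using (solve-∀)
open import Data.Sum using (inj₁; inj₂)
open import Relation.Binary.PropositionalEquality
open import Relation.Nullary using (yes; no)
open import Relation.Nullary.Negation using (contradiction)

2*n≡n+n : ∀ n → 2 * n ≡ n +ℕ n
2*n≡n+n n = cong (n +ℕ_) (ℕ.+-identityʳ n)

[m+n]Cm≡[m+n]Cn : ∀ m n → (m +ℕ n) C m ≡ (m +ℕ n) C n
[m+n]Cm≡[m+n]Cn m n =
  trans (nCk≡nC[n∸k] (ℕ.m≤m+n m n)) (cong ((m +ℕ n) C_) (ℕ.m+n∸m≡n m n))

ballot : ℕ → ℕ → ℤ
ballot n k = + (n C k) - + (n C suc k)

catalan : ℕ → ℤ
catalan r = ballot (r +ℕ r) r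

ballot-pascal : ∀ n k → ballot (suc n) (suc k) ≡ ballot n k + ballot n (suc k)
ballot-pascal n k = begin
  + (suc n C suc k) - + (suc n C suc (suc k))
    ≡⟨ cong₂ _-_ (split k) (split (suc k)) ⟩
  (+ (n C k) + + (n C suc k)) - (+ (n C suc k) + + (n C suc (suc k)))
    ≡⟨ telescope (+ (n C k)) (+ (n C suc k)) (+ (n C suc (suc k))) ⟩
  ballot n k + ballot n (suc k) ∎
  where
  open ≡-Reasoning
  split : ∀ j → + (suc n C suc j) ≡ + (n C j) + + (n C suc j)
  split j = trans (cong +_ (sym (nCk+nC[k+1]≡[n+1]C[k+1] n j))) (pos-+ (n C j) (n C suc j))
  telescope : ∀ x y z → (x + y) - (y + z) ≡ (x - y) + (y - z)
  telescope = solve-∀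

ballot-centre≡0 : ∀ k → ballot (k +ℕ suc k) k ≡ 0ℤ
ballot-centre≡0 k =
  trans (cong (λ c → + c - + ((k +ℕ suc k) C suc k)) ([m+n]Cm≡[m+n]Cn k (suc k)))
        (+-inverseʳ (+ ((k +ℕ suc k) C suc k)))

ballot-nonneg : ∀ n k → n ≤ℕ k +ℕ k → 0ℤ ≤ ballot n k
ballot-nonneg zero    zero    _ = +≤+ z≤n
ballot-nonneg zero    (suc k) _ = +≤+ z≤n
ballot-nonneg (suc n) (suc k) (s≤s n≤k+1+k) rewrite ballot-pascal n k =
  +-mono-≤ left (ballot-nonneg n (suc k) (ℕ.m≤n⇒m≤1+n n≤k+1+k))
  where
  left : 0ℤ ≤ ballot n k
  left with ℕ.m≤n⇒m<n∨m≡n n≤k+1+k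
  ... | inj₁ n<k+1+k = ballot-nonneg n k (ℕ.≤-pred (subst (suc n ≤ℕ_) (ℕ.+-suc k k) n<k+1+k))
  ... | inj₂ refl    = ≤-reflexive (sym (ballot-centre≡0 k))

ballot-≤-ballot-suc-suc : ∀ n k → n ≤ℕ suc k +ℕ suc k →
                          ballot n k ≤ ballot (suc n) (suc k)
ballot-≤-ballot-suc-suc n k n≤2k+2 = begin
  ballot n k                      ≡⟨ +-identityʳ (ballot n k) ⟨
  ballot n k + 0ℤ                 ≤⟨ +-monoʳ-≤ (ballot n k) (ballot-nonneg n (suc k) n≤2k+2) ⟩
  ballot n k + ballot n (suc k)   ≡⟨ ballot-pascal n k ⟨
  ballot (suc n) (suc k)          ∎
  where open ≤-Reasoning

catalan-suc : ∀ r → catalan (suc r) ≡ catalan r + ballot (r +ℕ r) (suc r)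
catalan-suc r = begin
  ballot (suc (r +ℕ suc r)) (suc r)
    ≡⟨ ballot-pascal (r +ℕ suc r) r ⟩
  ballot (r +ℕ suc r) r + ballot (r +ℕ suc r) (suc r)
    ≡⟨ cong (_+ ballot (r +ℕ suc r) (suc r)) (ballot-centre≡0 r) ⟩
  0ℤ + ballot (r +ℕ suc r) (suc r)
    ≡⟨ +-identityˡ (ballot (r +ℕ suc r) (suc r)) ⟩
  ballot (r +ℕ suc r) (suc r)
    ≡⟨ cong (λ n → ballot n (suc r)) (ℕ.+-suc r r) ⟩
  ballot (suc (r +ℕ r)) (suc r)
    ≡⟨ ballot-pascal (r +ℕ r) r ⟩
  catalan r + ballot (r +ℕ r) (suc r) ∎
  where open ≡-Reasoning

catalan-fibonacci-≤ : ∀ s → catalan (suc s) + catalan s ≤ catalan (suc (suc s))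
catalan-fibonacci-≤ s = begin
  catalan (suc s) + catalan s
    ≤⟨ +-monoʳ-≤ (catalan (suc s)) (≤-trans lower upper) ⟩
  catalan (suc s) + ballot (suc s +ℕ suc s) (suc (suc s))
    ≡⟨ catalan-suc (suc s) ⟨
  catalan (suc (suc s)) ∎
  where
  open ≤-Reasoning
  lower : catalan s ≤ ballot (s +ℕ suc s) (suc s)
  lower = subst (λ n → catalan s ≤ ballot n (suc s)) (sym (ℕ.+-suc s s))
    (ballot-≤-ballot-suc-suc (s +ℕ s) s
      (ℕ.+-mono-≤ (ℕ.n≤1+n s) (ℕ.n≤1+n s)))
  upper : ballot (s +ℕ suc s) (suc s) ≤ ballot (suc s +ℕ suc s) (suc (suc s))
  upper = ballot-≤-ballot-suc-suc (s +ℕ suc s) (suc s)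
    (ℕ.m≤n⇒m≤1+n (ℕ.+-mono-≤ (ℕ.n≤1+n s) (ℕ.n≤1+n (suc s))))

D≡ballot : ∀ n k → suc k ≤ℕ n → D n (suc k) ≡ ballot n k
D≡ballot n k k<n with suc k ≤? n
... | yes _   = refl
... | no k≮n = contradiction k<n k≮n

D-diagonal : ∀ k → D (2 * suc k) (suc k) ≡ - catalan (suc k)
D-diagonal k = begin
  D (2 * suc k) (suc k)
    ≡⟨ D≡ballot (2 * suc k) k (ℕ.m≤m+n (suc k) (suc k +ℕ 0)) ⟩
  ballot (2 * suc k) k
    ≡⟨ cong (λ n → ballot n k) (trans (2*n≡n+n (suc k)) (sym (ℕ.+-suc k (suc k)))) ⟩
  + (N C k) - + (N C suc k)
    ≡⟨ cong (λ c → + c - + (N C suc k)) ([m+n]Cm≡[m+n]Cn k (suc (suc k))) ⟩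
  + (N C suc (suc k)) - + (N C suc k)
    ≡⟨ swap (+ (N C suc k)) (+ (N C suc (suc k))) ⟩
  - ballot N (suc k)
    ≡⟨ cong (λ n → - ballot n (suc k)) (ℕ.+-suc k (suc k)) ⟩
  - catalan (suc k) ∎
  where
  open ≡-Reasoning
  N : ℕ
  N = k +ℕ suc (suc k)
  swap : ∀ x y → y - x ≡ - (x - y)
  swap = solve-∀

D-subdiagonal-≤ : ∀ k → D (2 * k) (suc k) ≤ catalan k
D-subdiagonal-≤ zero    = +≤+ z≤n
D-subdiagonal-≤ (suc j) = ≤-reflexive (begin
  D (2 * suc j) (suc (suc j))  ≡⟨ D≡ballot (2 * suc j) (suc j) j+2≤2j+2 ⟩
  ballot (2 * suc j) (suc j)   ≡⟨ cong (λ n → ballot n (suc j)) (2*n≡n+n (suc j)) ⟩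
  catalan (suc j)              ∎)
  where
  open ≡-Reasoning
  j+2≤2j+2 : suc (suc j) ≤ℕ 2 * suc j
  j+2≤2j+2 = subst (suc (suc j) ≤ℕ_) (sym (2*n≡n+n (suc j)))
    (s≤s (ℕ.m≤n+m (suc j) j))

1+sumD≤catalan : ∀ k → 1ℤ + sumD (suc k) ≤ catalan (suc k)
1+sumD≤catalan zero    = ≤-refl
1+sumD≤catalan (suc k) = begin
  1ℤ + (sumD (suc k) + D (2 * k) (suc k))  ≡⟨ +-assoc 1ℤ (sumD (suc k)) (D (2 * k) (suc k)) ⟨
  1ℤ + sumD (suc k) + D (2 * k) (suc k)    ≤⟨ +-mono-≤ (1+sumD≤catalan k) (D-subdiagonal-≤ k) ⟩
  catalan (suc k) + catalan k              ≤⟨ catalan-fibonacci-≤ k ⟩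
  catalan (suc (suc k))                    ∎
  where open ≤-Reasoning

lemma3p5 : (r : ℕ) → 0 Data.Nat.< r → D (2 * r) r + sumD r < + 0
lemma3p5 (suc k) _ = begin-strict
  D (2 * suc k) (suc k) + sumD (suc k)   ≡⟨ cong (_+ sumD (suc k)) (D-diagonal k) ⟩
  - catalan (suc k) + sumD (suc k)       <⟨ +-monoʳ-< (- catalan (suc k)) (suc[i]≤j⇒i<j (1+sumD≤catalan k)) ⟩
  - catalan (suc k) + catalan (suc k)    ≡⟨ +-inverseˡ (catalan (suc k)) ⟩
  + 0                                    ∎
  where open ≤-Reasoning
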